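{- Let $p$ be an odd prime number and let $\ell$ and $m$ be integers such that $1 \leq \ell \leq m \leq p-1$. For real $x < \ell p/m$ let \[ H_{\ell,m,p}(x) = \ell p - mx - 1 + \frac{mp}{\ell p - mx}. \] If $a \in \{0,1,\ldots,p-1\}$ satisfies \[ \frac{(\ell-1)p}{m} < a < \frac{\ell p - 1}{m}, \] then $h(a) < H_{\ell,m,p}(a)$. Furthermore, let $u$ and $v$ be real numbers such that \[ \frac{(\ell-1)p}{m} < u \leq \frac{\ell p}{m} - \sqrt{\frac{p}{m}} \leq v < \frac{\ell p - 1}{m}. \] If $a \in \{0,1,\ldots,p-1\}$ satisfies $u \leq a \leq v$, then $h(a) < \max(H_{\ell,m,p}(u), H_{\ell,m,p}(v))$.
   Context: For an integer $x$ and an odd prime $p$, $x \bmod p$ denotes the least nonnegative integer congruent to $x$ modulo $p$. For $a \in \{0,1,\ldots,p-1\}$ the height is defined by $h(a) = \min\{ k + (ka \bmod p) : k = 1,2,\ldots,p-1\}$.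
   Formalization: The numbers u and v in the second part range over the rationals rather than the reals. -}

module Defs where

open import Data.Nat as ℕ using (ℕ; zero; suc)
open import Data.Nat.DivMod using (_%_)
open import Data.List using (List; map; foldr; upTo)
open import Data.Integer using (ℤ; +_; -[1+_])
open import Data.Rational using (ℚ; mkℚ; 0ℚ; 1/_; _*_; _+_; _-_; _≤_; _/_)
open import Data.Sum using (_⊎_)
open import Data.Product using (_×_)

-- h(a) = min { k + (k a mod p) : k = 1, ..., p-1 }.
-- ks p = [1, ..., p-1]; the fold starts from the value at k = 1 (p ≥ 2 in use),
-- so the result is exactly the minimum over k ∈ {1,...,p-1}.
valueAt : (p a k : ℕ) .{{_ : ℕ.NonZero p}} → ℕ
valueAt p a k = k ℕ.+ ((k ℕ.* a) % p)

-- (p = 0 is a junk case, never used since p is prime)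
height : (p a : ℕ) → ℕ
height zero a = 0
height p@(suc _) a = foldr (λ k r → valueAt p a k ℕ.⊓ r) (valueAt p a 1)
                           (map suc (upTo (p ℕ.∸ 1)))

ℕ→ℚ : ℕ → ℚ
ℕ→ℚ n = + n / 1

-- total reciprocal (1/0 := 0); only ever applied to nonzero arguments
-- under the hypotheses of the theorem.
recip : ℚ → ℚ
recip (mkℚ (+ zero) _ _) = 0ℚ
recip q@(mkℚ (+ suc n) _ _) = 1/ q
recip q@(mkℚ -[1+ n ] _ _) = 1/ q

_÷_ : ℚ → ℚ → ℚ
x ÷ y = x * recip y

Hfun : (ℓ m p : ℕ) → ℚ → ℚ
Hfun ℓ m p x =
  ((ℕ→ℚ (ℓ ℕ.* p) - ℕ→ℚ m * x) - ℕ→ℚ 1)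
  + (ℕ→ℚ (m ℕ.* p) ÷ (ℕ→ℚ (ℓ ℕ.* p) - ℕ→ℚ m * x))

-- Comparisons with a square root of a nonnegative rational r,
-- written out literally:  x ≤ √r   and   √r ≤ x.
LeSqrt : ℚ → ℚ → Set
LeSqrt x r = x ≤ 0ℚ ⊎ (x * x ≤ r)

SqrtLe : ℚ → ℚ → Set
SqrtLe r x = (0ℚ ≤ x) × (r ≤ x * x)

{-# OPTIONS --safe #-}
-- Put d = ℓp − am, so 2 ≤ d < p, and divide p = t d + r; since p is prime, 0 < r < d.
-- The multiplier k = t m mod p is nonzero and k a ≡ −t d ≡ r (mod p), hence
-- h(a) ≤ k + r ≤ t m + r, and d (t m + r) + d ≤ d t m + d² < d² + m p.
-- Dividing by d gives h(a) < φ(d) = d − 1 + mp/d = H(a).  The function φ is quasiconvex on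
-- t > 0 (by (φ s − φ t) s t = (s − t)(s t − mp)) and d is decreasing in a, so on [u, v]
-- H is bounded by max(H(u), H(v)).
module Submission where

open import Defs

module HeightBound where

  open import Data.Nat
  open import Data.Nat.Properties
  open import Data.Nat.DivMod
  open import Data.Nat.Divisibility using (_∤_; m%n≡0⇒n∣m; >⇒∤)
  open import Data.Nat.Primality using (Prime; prime⇒nonZero; prime⇒irreducible; euclidsLemma)
  open import Data.Nat.Solver using (module +-*-Solver)
  open import Data.List using (_∷_; foldr)
  open import Data.List.Relation.Unary.Any using (here; there)
  open import Data.List.Membership.Propositional using (_∈_)
  open import Data.List.Membership.Propositional.Properties using (∈-map⁺; ∈-upTo⁺)
  open import Data.Sum using (inj₁; inj₂)
  open import Relation.Binary.PropositionalEquality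
  open +-*-Solver

  foldr-⊓-≤ : ∀ (g : ℕ → ℕ) b {k} xs → k ∈ xs → foldr (λ x r → g x ⊓ r) b xs ≤ g k
  foldr-⊓-≤ g b (x ∷ xs) (here refl)  = m⊓n≤m (g x) _
  foldr-⊓-≤ g b (x ∷ xs) (there k∈xs) = ≤-trans (m⊓n≤n (g x) _) (foldr-⊓-≤ g b xs k∈xs)

  height≤valueAt : ∀ p a k .{{_ : NonZero p}} → 0 < k → k < p → height p a ≤ valueAt p a k
  height≤valueAt (suc p) a (suc k) _ (s≤s k<p) =
    foldr-⊓-≤ (λ k → valueAt (suc p) a k) _ _ (∈-map⁺ suc (∈-upTo⁺ k<p))

  [m%n*o]%n≡[m*o]%n : ∀ m n o .{{_ : NonZero n}} → (m % n * o) % n ≡ (m * o) % n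
  [m%n*o]%n≡[m*o]%n m n o = begin
    (m % n * o) % n             ≡⟨ %-distribˡ-* (m % n) o n ⟩
    (m % n % n * (o % n)) % n   ≡⟨ cong (λ x → (x * (o % n)) % n) (m%n%n≡m%n m n) ⟩
    (m % n * (o % n)) % n       ≡⟨ %-distribˡ-* m o n ⟨
    (m * o) % n                 ∎
    where open ≡-Reasoning

  prime⇒nonTrivial∤ : ∀ {p d} → Prime p → 1 < d → d < p → d ∤ p
  prime⇒nonTrivial∤ pp 1<d d<p d∣p with prime⇒irreducible pp d∣p
  ... | inj₁ refl = <-irrefl refl 1<d
  ... | inj₂ refl = <-irrefl refl d<p

  prime∤* : ∀ {p m n} → Prime p → 0 < m → m < p → 0 < n → n < p → p ∤ m * n
  prime∤* pp 0<m m<p 0<n n<p p∣mn with euclidsLemma _ _ pp p∣mn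
  ... | inj₁ p∣m = >⇒∤ {{>-nonZero 0<m}} m<p p∣m
  ... | inj₂ p∣n = >⇒∤ {{>-nonZero 0<n}} n<p p∣n

  -- a m ≡ −d (mod p), so (p / d) m a ≡ −(p / d) d = p % d − p.
  [p/d*m*a]%p≡p%d : ∀ {p a m ℓ d} .{{_ : NonZero p}} .{{_ : NonZero d}} →
                    d < p → a * m + d ≡ ℓ * p → (p / d * m * a) % p ≡ p % d
  [p/d*m*a]%p≡p%d {p} {a} {m} {ℓ} {d} d<p am+d≡ℓp = begin
    (t * m * a) % p        ≡⟨ [m+n]%n≡m%n (t * m * a) p ⟨
    (t * m * a + p) % p    ≡⟨ cong (_% p) shifted ⟩
    (r + t * ℓ * p) % p    ≡⟨ [m+kn]%n≡m%n r (t * ℓ) p ⟩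
    r % p                  ≡⟨ m<n⇒m%n≡m (<-trans (m%n<n p d) d<p) ⟩
    r                      ∎
    where
    open ≡-Reasoning
    t = p / d
    r = p % d
    shifted : t * m * a + p ≡ r + t * ℓ * p
    shifted = begin
      t * m * a + p          ≡⟨ cong (t * m * a +_) (m≡m%n+[m/n]*n p d) ⟩
      t * m * a + (r + t * d) ≡⟨ solve 5 (λ t m a r d → t :* m :* a :+ (r :+ t :* d)
                                               := r :+ t :* (a :* m :+ d)) refl t m a r d ⟩
      r + t * (a * m + d)    ≡⟨ cong (λ x → r + t * x) am+d≡ℓp ⟩
      r + t * (ℓ * p)        ≡⟨ cong (r +_) (*-assoc t ℓ p) ⟨
      r + t * ℓ * p          ∎

  height≤[p/d]*m+p%d : ∀ {p a m ℓ d} .{{_ : NonZero d}} → Prime p → 0 < m → m < p →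
                       1 < d → d < p → a * m + d ≡ ℓ * p → height p a ≤ p / d * m + p % d
  height≤[p/d]*m+p%d {p} {a} {m} {ℓ} {d} pp 0<m m<p 1<d d<p am+d≡ℓp = begin
    height p a           ≤⟨ height≤valueAt p a k (n≢0⇒n>0 k≢0) (m%n<n (t * m) p) ⟩
    k + (k * a) % p      ≡⟨ cong (k +_) ([m%n*o]%n≡[m*o]%n (t * m) p a) ⟩
    k + (t * m * a) % p  ≡⟨ cong (k +_) ([p/d*m*a]%p≡p%d {ℓ = ℓ} d<p am+d≡ℓp) ⟩
    k + p % d            ≤⟨ +-monoˡ-≤ (p % d) (m%n≤m (t * m) p) ⟩
    t * m + p % d        ∎
    where
    open ≤-Reasoning
    instance
      _ : NonZero p
      _ = prime⇒nonZero pp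
    t = p / d
    k = (t * m) % p
    k≢0 : k ≢ 0
    k≢0 k≡0 = prime∤* pp (m≥n⇒m/n>0 (<⇒≤ d<p)) (m/n<m p d 1<d) 0<m m<p
                      (m%n≡0⇒n∣m (t * m) p k≡0)

  division-estimate : ∀ {p m d} .{{_ : NonZero d}} → 0 < m → 0 < p % d →
                      d * (p / d * m + p % d) + d < d * d + m * p
  division-estimate {p} {m} {d} 0<m 0<r = begin-strict
    d * (t * m + r) + d       ≡⟨ solve 4 (λ d t m r → d :* (t :* m :+ r) :+ d
                                           := d :* t :* m :+ d :* (con 1 :+ r)) refl d t m r ⟩
    d * t * m + d * suc r     ≤⟨ +-monoʳ-≤ (d * t * m) (*-monoʳ-≤ d (m%n<n p d)) ⟩
    d * t * m + d * d         <⟨ m<m+n (d * t * m + d * d) (*-mono-< 0<m 0<r) ⟩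
    d * t * m + d * d + m * r ≡⟨ solve 4 (λ d t m r → d :* t :* m :+ d :* d :+ m :* r
                                           := d :* d :+ m :* (r :+ t :* d)) refl d t m r ⟩
    d * d + m * (r + t * d)   ≡⟨ cong (λ x → d * d + m * x) (m≡m%n+[m/n]*n p d) ⟨
    d * d + m * p             ∎
    where
    open ≤-Reasoning
    t = p / d
    r = p % d

  height-gap-bound : ∀ {p a m ℓ d} → Prime p → 0 < m → m < p → 1 < d → d < p →
                     a * m + d ≡ ℓ * p → d * height p a + d < d * d + m * p
  height-gap-bound {p} {a} {m} {ℓ} {d} pp 0<m m<p 1<d d<p am+d≡ℓp = begin-strict
    d * height p a + d           ≤⟨ +-monoˡ-≤ d (*-monoʳ-≤ d height≤) ⟩
    d * (p / d * m + p % d) + d  <⟨ division-estimate 0<m (n≢0⇒n>0 p%d≢0) ⟩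
    d * d + m * p                ∎
    where
    open ≤-Reasoning
    instance
      _ : NonZero d
      _ = >-nonZero (<-trans z<s 1<d)
    height≤ : height p a ≤ p / d * m + p % d
    height≤ = height≤[p/d]*m+p%d {ℓ = ℓ} pp 0<m m<p 1<d d<p am+d≡ℓp
    p%d≢0 : p % d ≢ 0
    p%d≢0 p%d≡0 = prime⇒nonTrivial∤ pp 1<d d<p (m%n≡0⇒n∣m p d p%d≡0)

  1<[1+ℓ]*p∸n : ∀ {ℓ p n} → n + 1 < suc ℓ * p → 1 < suc ℓ * p ∸ n
  1<[1+ℓ]*p∸n {ℓ} {p} {n} n+1<[1+ℓ]p =
    m+n≤o⇒m≤o∸n 2 (subst (_≤ suc ℓ * p) (cong suc (+-comm n 1)) n+1<[1+ℓ]p)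

  [1+ℓ]*p∸n<p : ∀ {ℓ p n} .{{_ : NonZero p}} → ℓ * p < n → suc ℓ * p ∸ n < p
  [1+ℓ]*p∸n<p {ℓ} {p} {n} ℓp<n =
    m<n+o⇒m∸n<o (suc ℓ * p) n (subst (p + ℓ * p <_) (+-comm p n) (+-monoʳ-< p ℓp<n))

open HeightBound using (height-gap-bound; 1<[1+ℓ]*p∸n; [1+ℓ]*p∸n<p)

open import Data.Nat as ℕ using (ℕ; zero; suc; _∸_; z<s)
open import Data.Nat.Primality using (Prime; prime⇒nonZero)
open import Data.Product using (_×_; _,_)
import Data.Nat.Properties as ℕₚ
open import Data.Nat.Coprimality using (1-coprimeTo) renaming (sym to coprime-sym)
open import Data.Integer as ℤ using (+_; +0; +[1+_]; -[1+_])
import Data.Integer.Properties as ℤₚ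
open import Data.Rational hiding (_÷_)
open import Data.Rational.Properties
open import Data.Rational.Solver using (module +-*-Solver)
open import Data.Sum using (inj₁; inj₂)
open import Relation.Binary.PropositionalEquality
open +-*-Solver

ℕ→ℚ≡mkℚ : ∀ n → ℕ→ℚ n ≡ mkℚ (+ n) 0 (coprime-sym (1-coprimeTo n))
ℕ→ℚ≡mkℚ n = normalize-coprime (coprime-sym (1-coprimeTo n))

ℕ→ℚ-homo-+ : ∀ m n → ℕ→ℚ (m ℕ.+ n) ≡ ℕ→ℚ m + ℕ→ℚ n
ℕ→ℚ-homo-+ m n rewrite ℕ→ℚ≡mkℚ m | ℕ→ℚ≡mkℚ n =
  cong (_/ 1) (sym (cong₂ ℤ._+_ (ℤₚ.*-identityʳ (+ m)) (ℤₚ.*-identityʳ (+ n))))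

ℕ→ℚ-homo-* : ∀ m n → ℕ→ℚ (m ℕ.* n) ≡ ℕ→ℚ m * ℕ→ℚ n
ℕ→ℚ-homo-* m n rewrite ℕ→ℚ≡mkℚ m | ℕ→ℚ≡mkℚ n = cong (_/ 1) (ℤₚ.pos-* m n)

ℕ→ℚ-mono-< : ∀ {m n} → m ℕ.< n → ℕ→ℚ m < ℕ→ℚ n
ℕ→ℚ-mono-< {m} {n} m<n rewrite ℕ→ℚ≡mkℚ m | ℕ→ℚ≡mkℚ n =
  *<* (subst₂ ℤ._<_ (sym (ℤₚ.*-identityʳ (+ m))) (sym (ℤₚ.*-identityʳ (+ n))) (ℤ.+<+ m<n))

ℕ→ℚ-cancel-< : ∀ {m n} → ℕ→ℚ m < ℕ→ℚ n → m ℕ.< n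
ℕ→ℚ-cancel-< {m} {n} m<n rewrite ℕ→ℚ≡mkℚ m | ℕ→ℚ≡mkℚ n with m<n
... | *<* m<n′ = ℤₚ.drop‿+<+ (subst₂ ℤ._<_ (ℤₚ.*-identityʳ (+ m)) (ℤₚ.*-identityʳ (+ n)) m<n′)

*-recipʳ : ∀ {q} → 0ℚ < q → q * recip q ≡ 1ℚ
*-recipʳ {q@(mkℚ +[1+ n ] _ _)} _ = *-inverseʳ q
*-recipʳ {mkℚ +0 _ _} (*<* (ℤ.+<+ ()))
*-recipʳ {mkℚ -[1+ n ] _ _} (*<* ())

÷-*-cancel : ∀ x {q} → 0ℚ < q → x ÷ q * q ≡ x
÷-*-cancel x {q} 0<q = begin
  x * recip q * q     ≡⟨ *-assoc x (recip q) q ⟩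
  x * (recip q * q)   ≡⟨ cong (x *_) (trans (*-comm (recip q) q) (*-recipʳ 0<q)) ⟩
  x * 1ℚ              ≡⟨ *-identityʳ x ⟩
  x                   ∎
  where open ≡-Reasoning

÷<⇒<* : ∀ {x y q} → 0ℚ < q → x ÷ q < y → x < y * q
÷<⇒<* {x} {y} {q} 0<q x/q<y =
  subst (_< y * q) (÷-*-cancel x 0<q) (*-monoˡ-<-pos q {{positive 0<q}} x/q<y)

<÷⇒*< : ∀ {x y q} → 0ℚ < q → y < x ÷ q → y * q < x
<÷⇒*< {x} {y} {q} 0<q y<x/q =
  subst (y * q <_) (÷-*-cancel x 0<q) (*-monoˡ-<-pos q {{positive 0<q}} y<x/q)

<-⇒+< : ∀ {x y z} → x < y - z → x + z < y
<-⇒+< {x} {y} {z} x<y-z =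
  subst (x + z <_) (solve 2 (λ y z → (y :- z) :+ z := y) refl y z) (+-monoˡ-< z x<y-z)

+<⇒<- : ∀ {x y z} → x + z < y → x < y - z
+<⇒<- {x} {y} {z} x+z<y =
  subst (_< y - z) (solve 2 (λ x z → (x :+ z) :- z := x) refl x z) (+-monoˡ-< (- z) x+z<y)

≤⇒0≤- : ∀ {x y} → x ≤ y → 0ℚ ≤ y - x
≤⇒0≤- {x} {y} x≤y = subst (_≤ y - x) (+-inverseʳ x) (+-monoˡ-≤ (- x) x≤y)

0≤*0≤⇒0≤* : ∀ {x y} → 0ℚ ≤ x → 0ℚ ≤ y → 0ℚ ≤ x * y
0≤*0≤⇒0≤* {x} {y} 0≤x 0≤y =
  nonNegative⁻¹ (x * y) {{nonNeg*nonNeg⇒nonNeg x {{nonNegative 0≤x}} y {{nonNegative 0≤y}}}}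

-- Hfun ℓ m p x is definitionally φ (m * p) (ℓ * p − m * x).
φ : ℚ → ℚ → ℚ
φ c t = (t - 1ℚ) + c ÷ t

*-φ : ∀ c {t} → 0ℚ < t → t * φ c t ≡ (t * t + c) - t
*-φ c {t} 0<t = begin
  t * ((t - 1ℚ) + c * recip t)    ≡⟨ expand ⟩
  (t * t - t) + c * (t * recip t) ≡⟨ cong (λ x → (t * t - t) + c * x) (*-recipʳ 0<t) ⟩
  (t * t - t) + c * 1ℚ            ≡⟨ solve 2 (λ t c → (t :* t :- t) :+ c :* con 1ℚ := (t :* t :+ c) :- t) refl t c ⟩
  (t * t + c) - t                 ∎
  where
  open ≡-Reasoning
  expand : t * ((t - 1ℚ) + c * recip t) ≡ (t * t - t) + c * (t * recip t)
  expand = solve 3 (λ t c r → t :* ((t :- con 1ℚ) :+ c :* r) := (t :* t :- t) :+ c :* (t :* r))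
                   refl t c (recip t)

*+<⇒<φ : ∀ {c t x} → 0ℚ < t → t * x + t < t * t + c → x < φ c t
*+<⇒<φ {c} {t} {x} 0<t tx+t<tt+c =
  *-cancelˡ-<-nonNeg t {{pos⇒nonNeg t {{positive 0<t}}}}
    (subst (t * x <_) (sym (*-φ c 0<t)) (+<⇒<- tx+t<tt+c))

φ-shift : ∀ c {s t} → 0ℚ < s → 0ℚ < t → t * s * φ c s ≡ t * s * φ c t + (s - t) * (t * s - c)
φ-shift c {s} {t} 0<s 0<t = begin
  t * s * φ c s             ≡⟨ *-assoc t s (φ c s) ⟩
  t * (s * φ c s)           ≡⟨ cong (t *_) (*-φ c 0<s) ⟩
  t * ((s * s + c) - s)     ≡⟨ regroup ⟩
  s * ((t * t + c) - t) + δ ≡⟨ cong (λ x → s * x + δ) (*-φ c 0<t) ⟨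
  s * (t * φ c t) + δ       ≡⟨ cong (_+ δ) (solve 3 (λ s t f → s :* (t :* f) := t :* s :* f) refl s t (φ c t)) ⟩
  t * s * φ c t + δ         ∎
  where
  open ≡-Reasoning
  δ = (s - t) * (t * s - c)
  regroup : t * ((s * s + c) - s) ≡ s * ((t * t + c) - t) + δ
  regroup = solve 3 (λ s t c → t :* ((s :* s :+ c) :- s)
                               := s :* ((t :* t :+ c) :- t) :+ (s :- t) :* (t :* s :- c)) refl s t c

φ-≤ : ∀ c {s t} → 0ℚ < s → 0ℚ < t → 0ℚ ≤ (s - t) * (t * s - c) → φ c t ≤ φ c s
φ-≤ c {s} {t} 0<s 0<t 0≤δ =
  *-cancelˡ-≤-pos (t * s) {{pos*pos⇒pos t {{positive 0<t}} s {{positive 0<s}}}} (begin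
  t * s * φ c t                         ≡⟨ +-identityʳ _ ⟨
  t * s * φ c t + 0ℚ                    ≤⟨ +-monoʳ-≤ (t * s * φ c t) 0≤δ ⟩
  t * s * φ c t + (s - t) * (t * s - c) ≡⟨ φ-shift c 0<s 0<t ⟨
  t * s * φ c s                         ∎)
  where open ≤-Reasoning

φ-monoʳ-≤ : ∀ c {t s} → 0ℚ < t → t ≤ s → c ≤ t * s → φ c t ≤ φ c s
φ-monoʳ-≤ c 0<t t≤s c≤ts =
  φ-≤ c (<-≤-trans 0<t t≤s) 0<t (0≤*0≤⇒0≤* (≤⇒0≤- t≤s) (≤⇒0≤- c≤ts))

φ-antimonoʳ-≤ : ∀ c {t s} → 0ℚ < t → t ≤ s → t * s ≤ c → φ c s ≤ φ c t
φ-antimonoʳ-≤ c {t} {s} 0<t t≤s ts≤c =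
  φ-≤ c 0<t (<-≤-trans 0<t t≤s) (subst (0ℚ ≤_) flip (0≤*0≤⇒0≤* (≤⇒0≤- t≤s) (≤⇒0≤- ts≤c)))
  where
  flip : (s - t) * (c - t * s) ≡ (t - s) * (s * t - c)
  flip = solve 3 (λ s t c → (s :- t) :* (c :- t :* s) := (t :- s) :* (s :* t :- c)) refl s t c

φ-quasiconvex : ∀ c {x y z} → 0ℚ < x → x ≤ y → y ≤ z → φ c y ≤ φ c x ⊔ φ c z
φ-quasiconvex c {x} {y} {z} 0<x x≤y y≤z with ≤-total c (x * y)
... | inj₁ c≤xy = ≤-trans (φ-monoʳ-≤ c 0<y y≤z (≤-trans c≤xy xy≤yz)) (p≤q⊔p (φ c x) (φ c z))
  where
  0<y : 0ℚ < y
  0<y = <-≤-trans 0<x x≤y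
  xy≤yz : x * y ≤ y * z
  xy≤yz = subst (x * y ≤_) (*-comm z y)
                (*-monoʳ-≤-nonNeg y {{pos⇒nonNeg y {{positive 0<y}}}} (≤-trans x≤y y≤z))
... | inj₂ xy≤c = ≤-trans (φ-antimonoʳ-≤ c 0<x x≤y xy≤c) (p≤p⊔q (φ c x) (φ c z))

ℕ→ℚ-homo-*+ : ∀ a b c → ℕ→ℚ (a ℕ.* b ℕ.+ c) ≡ ℕ→ℚ a * ℕ→ℚ b + ℕ→ℚ c
ℕ→ℚ-homo-*+ a b c = trans (ℕ→ℚ-homo-+ (a ℕ.* b) c) (cong (_+ ℕ→ℚ c) (ℕ→ℚ-homo-* a b))

n/m<a⇒n<a*m : ∀ {n m a} → 0 ℕ.< m → ℕ→ℚ n ÷ ℕ→ℚ m < ℕ→ℚ a → n ℕ.< a ℕ.* m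
n/m<a⇒n<a*m {n} {m} {a} 0<m n/m<a =
  ℕ→ℚ-cancel-< (subst (ℕ→ℚ n <_) (sym (ℕ→ℚ-homo-* a m)) (÷<⇒<* (ℕ→ℚ-mono-< 0<m) n/m<a))

a<[n-k]/m⇒a*m+k<n : ∀ {n m a k} → 0 ℕ.< m →
                    ℕ→ℚ a < (ℕ→ℚ n - ℕ→ℚ k) ÷ ℕ→ℚ m → a ℕ.* m ℕ.+ k ℕ.< n
a<[n-k]/m⇒a*m+k<n {n} {m} {a} {k} 0<m a<[n-k]/m =
  ℕ→ℚ-cancel-< (subst (_< ℕ→ℚ n) (sym (ℕ→ℚ-homo-*+ a m k))
                       (<-⇒+< (<÷⇒*< (ℕ→ℚ-mono-< 0<m) a<[n-k]/m)))

height<Hfun : ∀ {p ℓ m a} → Prime p → 0 ℕ.< m → m ℕ.< p →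
              ℓ ℕ.* p ℕ.< a ℕ.* m → a ℕ.* m ℕ.+ 1 ℕ.< suc ℓ ℕ.* p →
              ℕ→ℚ (height p a) < Hfun (suc ℓ) m p (ℕ→ℚ a)
height<Hfun {p} {ℓ} {m} {a} pp 0<m m<p ℓp<am am+1<[1+ℓ]p =
  subst (λ t → ℕ→ℚ (height p a) < φ (ℕ→ℚ (m ℕ.* p)) t) (sym gap≡d)
    (*+<⇒<φ (ℕ→ℚ-mono-< (ℕₚ.<-trans z<s 1<d))
      (subst₂ _<_ (ℕ→ℚ-homo-*+ d (height p a) d) (ℕ→ℚ-homo-*+ d d (m ℕ.* p))
        (ℕ→ℚ-mono-< (height-gap-bound {ℓ = suc ℓ} pp 0<m m<p 1<d d<p am+d≡[1+ℓ]p))))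
  where
  instance
    _ : ℕ.NonZero p
    _ = prime⇒nonZero pp
  d = suc ℓ ℕ.* p ∸ a ℕ.* m
  A = ℕ→ℚ a
  M = ℕ→ℚ m
  D = ℕ→ℚ d
  1<d : 1 ℕ.< d
  1<d = 1<[1+ℓ]*p∸n {ℓ} {p} am+1<[1+ℓ]p
  d<p : d ℕ.< p
  d<p = [1+ℓ]*p∸n<p {ℓ} {p} ℓp<am
  am+d≡[1+ℓ]p : a ℕ.* m ℕ.+ d ≡ suc ℓ ℕ.* p
  am+d≡[1+ℓ]p = ℕₚ.m+[n∸m]≡n (ℕₚ.<⇒≤ (ℕₚ.≤-<-trans (ℕₚ.m≤m+n (a ℕ.* m) 1) am+1<[1+ℓ]p))
  gap≡d : ℕ→ℚ (suc ℓ ℕ.* p) - M * A ≡ D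
  gap≡d = begin
    ℕ→ℚ (suc ℓ ℕ.* p) - M * A    ≡⟨ cong (λ x → ℕ→ℚ x - M * A) am+d≡[1+ℓ]p ⟨
    ℕ→ℚ (a ℕ.* m ℕ.+ d) - M * A  ≡⟨ cong (_- M * A) (ℕ→ℚ-homo-*+ a m d) ⟩
    (A * M + D) - M * A          ≡⟨ solve 3 (λ a m d → (a :* m :+ d) :- m :* a := d) refl A M D ⟩
    D                            ∎
    where open ≡-Reasoning

Hfun-quasiconvex : ∀ ℓ m p {u x v} → 0 ℕ.< m → v < (ℕ→ℚ (ℓ ℕ.* p) - 1ℚ) ÷ ℕ→ℚ m →
                   u ≤ x → x ≤ v → Hfun ℓ m p x ≤ Hfun ℓ m p u ⊔ Hfun ℓ m p v
Hfun-quasiconvex ℓ m p {u} {x} {v} 0<m v<bound u≤x x≤v =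
  subst (Hfun ℓ m p x ≤_) (⊔-comm (Hfun ℓ m p v) (Hfun ℓ m p u))
    (φ-quasiconvex (ℕ→ℚ (m ℕ.* p)) 0<gap[v] (gap-antimono x≤v) (gap-antimono u≤x))
  where
  L = ℕ→ℚ (ℓ ℕ.* p)
  M = ℕ→ℚ m
  0<M : 0ℚ < M
  0<M = ℕ→ℚ-mono-< 0<m
  gap-antimono : ∀ {y z} → y ≤ z → L - M * z ≤ L - M * y
  gap-antimono y≤z =
    +-monoʳ-≤ L (neg-antimono-≤ (*-monoˡ-≤-nonNeg M {{pos⇒nonNeg M {{positive 0<M}}}} y≤z))
  1+Mv<L : 1ℚ + M * v < L
  1+Mv<L = subst (_< L) (solve 2 (λ v M → v :* M :+ con 1ℚ := con 1ℚ :+ M :* v) refl v M)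
                 (<-⇒+< (<÷⇒*< 0<M v<bound))
  0<gap[v] : 0ℚ < L - M * v
  0<gap[v] = <-trans (ℕ→ℚ-mono-< {0} {1} z<s) (+<⇒<- 1+Mv<L)

mainTheorem4 :
  (p ℓ m : ℕ) → Prime p → p ≢ 2 →
  1 ℕ.≤ ℓ → ℓ ℕ.≤ m → m ℕ.≤ p ∸ 1 →
  ((a : ℕ) → a ℕ.< p →
    ℕ→ℚ ((ℓ ∸ 1) ℕ.* p) ÷ ℕ→ℚ m < ℕ→ℚ a →
    ℕ→ℚ a < (ℕ→ℚ (ℓ ℕ.* p) - ℕ→ℚ 1) ÷ ℕ→ℚ m →
    ℕ→ℚ (height p a) < Hfun ℓ m p (ℕ→ℚ a))
  ×
  ((u v : ℚ) →
    ℕ→ℚ ((ℓ ∸ 1) ℕ.* p) ÷ ℕ→ℚ m < u →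
    SqrtLe (ℕ→ℚ p ÷ ℕ→ℚ m) (ℕ→ℚ (ℓ ℕ.* p) ÷ ℕ→ℚ m - u) →
    LeSqrt (ℕ→ℚ (ℓ ℕ.* p) ÷ ℕ→ℚ m - v) (ℕ→ℚ p ÷ ℕ→ℚ m) →
    v < (ℕ→ℚ (ℓ ℕ.* p) - ℕ→ℚ 1) ÷ ℕ→ℚ m →
    (a : ℕ) → a ℕ.< p → u ≤ ℕ→ℚ a → ℕ→ℚ a ≤ v →
    ℕ→ℚ (height p a) < (Hfun ℓ m p u ⊔ Hfun ℓ m p v))
mainTheorem4 p zero m _ _ () _ _
mainTheorem4 p (suc ℓ) m pp _ _ 1+ℓ≤m m≤p∸1 =
    (λ a _ → below a)
  , λ u v u>lower _ _ v<upper a _ u≤a a≤v →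
      <-≤-trans (below a (<-≤-trans u>lower u≤a) (≤-<-trans a≤v v<upper))
                (Hfun-quasiconvex (suc ℓ) m p 0<m v<upper u≤a a≤v)
  where
  0<m : 0 ℕ.< m
  0<m = ℕₚ.<-≤-trans z<s 1+ℓ≤m
  m<p : m ℕ.< p
  m<p = ℕₚ.m≤pred[n]⇒suc[m]≤n {{prime⇒nonZero pp}} m≤p∸1
  below : ∀ a → ℕ→ℚ (ℓ ℕ.* p) ÷ ℕ→ℚ m < ℕ→ℚ a →
          ℕ→ℚ a < (ℕ→ℚ (suc ℓ ℕ.* p) - 1ℚ) ÷ ℕ→ℚ m →
          ℕ→ℚ (height p a) < Hfun (suc ℓ) m p (ℕ→ℚ a)
  below a lower upper =
    height<Hfun {p} {ℓ} {m} {a} pp 0<m m<p (n/m<a⇒n<a*m {ℓ ℕ.* p} {m} {a} 0<m lower)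
      (a<[n-k]/m⇒a*m+k<n {suc ℓ ℕ.* p} {m} {a} {1} 0<m upper)
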